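{- Let $a\geq 3$ and $m\geq 2a^2-a+2$ be integers and let $C(m,a)=\left\lceil\frac{m-1}{a}\left\lceil\frac{m-1}{a}\right\rceil\right\rceil$. Then every coloring of $[C(m,a)]=\{1,\ldots,C(m,a)\}$ with the two colors red and blue in which $a-2$ is red and $a-1$ is blue admits a monochromatic solution of $x_1+x_2+\cdots+x_{m-1}=ax_m$.
   Context: A solution in $[n]$ is an assignment of values in $[n]$ to $x_1,\ldots,x_m$ (not necessarily distinct) making the equation true; it is monochromatic if all the values $x_1,\ldots,x_m$ have the same color. -}

module Defs where

open import Data.Nat using (ℕ; suc; _+_; _*_; _∸_; _/_; _≤_; NonZero)
open import Data.Nat.ListAction using (sum)
open import Data.Fin using (Fin)
open import Data.List using (List; map; allFin)
open import Data.Bool using (Bool)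
open import Data.Product using (Σ; _×_)
open import Relation.Binary.PropositionalEquality using (_≡_)

⌈_/_⌉ : ℕ → (d : ℕ) → .{{NonZero d}} → ℕ
⌈ n / d ⌉ = (n + d ∸ 1) / d

-- C(m,a) = ⌈ ((m-1)/a) * ⌈ (m-1)/a ⌉ ⌉ = ⌈ ((m-1) * ⌈ (m-1)/a ⌉) / a ⌉
C : (m a : ℕ) → .{{NonZero a}} → ℕ
C m a = ⌈ (m ∸ 1) * ⌈ m ∸ 1 / a ⌉ / a ⌉

-- A 2-colouring: true = red, false = blue (only values in [1,N] matter)
Colouring : Set
Colouring = ℕ → Bool

sumFin : (k : ℕ) → (Fin k → ℕ) → ℕ
sumFin k x = sum (map x (allFin k))

InRange : ℕ → ℕ → Set
InRange N v = (1 ≤ v) × (v ≤ N)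

MonoSolution : (N m a : ℕ) → Colouring → Set
MonoSolution N m a χ =
  Σ (Fin (m ∸ 1) → ℕ) λ x → Σ ℕ λ y →
    ((i : Fin (m ∸ 1)) → InRange N (x i)) × InRange N y ×
    (sumFin (m ∸ 1) x ≡ a * y) ×
    ((i : Fin (m ∸ 1)) → χ (x i) ≡ χ y)

-- Write k = m − 1 (the number of summands), b = a − 2 (red), a − 1 (blue).
-- Every solution below takes only two values on the left-hand side, so it is
-- described by multiplicities n₁ + n₂ = k of values p, q with n₁p + n₂q = a·y.
-- Put Y = k − 2 and U = k − a − 1.  Splitting on the colours of a, Y and U:
--   a blue, Y red          : Y·(a−2) + 2·Y             = a·Y   (red)
--   a blue, Y blue         : 2a·(a−1) + (k−2a)·a        = a·Y   (blue)
--   a red,  Y red          : a·(a−2) + (k−a)·a          = a·Y   (red)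
--   a red,  Y blue, U red  : j·(a−2) + (k−j)·a          = a·U   (red), 2j = a(a+1)
--   a red,  Y blue, U blue : (k−1)·(a−1) + 1·U          = a·Y   (blue)
-- All values lie in [k] as soon as a² ≤ k, so this gives a solution in [k]
-- (Core.monochromaticSolution).  The theorem follows because the hypothesis
-- on m gives a² ≤ k (a²≤m-1), and a² ≤ k also gives k ≤ C(m,a) (k≤C).
module Submission where

open import Defs
open import Data.Nat using (ℕ; zero; suc; _+_; _*_; _∸_; _/_; _≤_; z≤n; s≤s; NonZero)
open import Data.Nat.Properties
open import Data.Nat.DivMod using (m*n/n≡m; /-monoˡ-≤)
open import Data.Nat.Tactic.RingSolver using (solve-∀)
open import Data.Nat.ListAction using (sum)
open import Data.Bool using (Bool; true; false)
open import Data.Fin using (Fin)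
open import Data.List using (tabulate)
open import Data.List.Properties using (map-tabulate)
open import Data.Vec as Vec using (Vec; []; _∷_; lookup; replicate; _++_)
open import Data.Vec.Properties using (sum-++)
open import Data.Vec.Relation.Unary.All using (All; []; _∷_)
open import Data.Vec.Relation.Unary.All.Properties using (lookup⁺; ++⁺)
open import Data.Product using (Σ; _×_; _,_; proj₁; proj₂)
open import Relation.Nullary using (yes; no; contradiction)
open import Relation.Binary.PropositionalEquality
  using (_≡_; refl; sym; trans; cong; cong₂; subst; module ≡-Reasoning)

-- A monochromatic solution in [N] of x₁ + ⋯ + x_k = a·y, for any number k of
-- summands; MonoSolution N m a χ is exactly Solution N (m ∸ 1) a χ.
Solution : (N k a : ℕ) → Colouring → Set
Solution N k a χ =
  Σ (Fin k → ℕ) λ x → Σ ℕ λ y →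
    ((i : Fin k) → InRange N (x i)) × InRange N y ×
    (sumFin k x ≡ a * y) ×
    ((i : Fin k) → χ (x i) ≡ χ y)

solution-mono : ∀ {N N' k a χ} → N ≤ N' → Solution N k a χ → Solution N' k a χ
solution-mono N≤N' (x , y , x∈ , (1≤y , y≤N) , sum≡ , mono) =
  x , y , (λ i → let (1≤xᵢ , xᵢ≤N) = x∈ i in 1≤xᵢ , ≤-trans xᵢ≤N N≤N')
    , (1≤y , ≤-trans y≤N N≤N') , sum≡ , mono

sumFin-lookup : ∀ {k} (v : Vec ℕ k) → sumFin k (lookup v) ≡ Vec.sum v
sumFin-lookup v = trans (cong sum (map-tabulate (λ i → i) (lookup v))) (sum-tabulate v)
  where
  sum-tabulate : ∀ {n} (w : Vec ℕ n) → sum (tabulate (lookup w)) ≡ Vec.sum w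
  sum-tabulate []      = refl
  sum-tabulate (x ∷ w) = cong (x +_) (sum-tabulate w)

sum-replicate : ∀ n p → Vec.sum (replicate n p) ≡ n * p
sum-replicate zero    p = refl
sum-replicate (suc n) p = cong (p +_) (sum-replicate n p)

all-replicate : ∀ {P : ℕ → Set} n {p} → P p → All P (replicate n p)
all-replicate zero    Pp = []
all-replicate (suc n) Pp = Pp ∷ all-replicate n Pp

twoValueSolution : ∀ {N a} {χ : Colouring} (n₁ n₂ p q y : ℕ) {k : ℕ} →
  n₁ + n₂ ≡ k → n₁ * p + n₂ * q ≡ a * y →
  InRange N p → InRange N q → InRange N y →
  χ p ≡ χ y → χ q ≡ χ y → Solution N k a χ
twoValueSolution {N} {a} {χ} n₁ n₂ p q y refl sum≡ p∈ q∈ y∈ χp χq =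
  lookup v , y , (λ i → fst (lookup⁺ good i)) , y∈ , sumv≡ , (λ i → snd (lookup⁺ good i))
  where
  v : Vec ℕ (n₁ + n₂)
  v = replicate n₁ p ++ replicate n₂ q
  Good : ℕ → Set
  Good x = InRange N x × (χ x ≡ χ y)
  good : All Good v
  good = ++⁺ (all-replicate n₁ (p∈ , χp)) (all-replicate n₂ (q∈ , χq))
  fst : ∀ {x} → Good x → InRange N x
  fst (x∈ , _) = x∈
  snd : ∀ {x} → Good x → χ x ≡ χ y
  snd (_ , χx) = χx
  open ≡-Reasoning
  sumv≡ : sumFin (n₁ + n₂) (lookup v) ≡ a * y
  sumv≡ = begin
    sumFin (n₁ + n₂) (lookup v)                          ≡⟨ sumFin-lookup v ⟩
    Vec.sum v                                            ≡⟨ sum-++ (replicate n₁ p) ⟩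
    Vec.sum (replicate n₁ p) + Vec.sum (replicate n₂ q)  ≡⟨ cong₂ _+_ (sum-replicate n₁ p) (sum-replicate n₂ q) ⟩
    n₁ * p + n₂ * q                                      ≡⟨ sum≡ ⟩
    a * y                                                ∎

-- n(n+1) is even: it is j + j for some j (the multiplicity j = a(a+1)/2).
pronic-half : ∀ n → Σ ℕ λ j → j + j ≡ n * suc n
pronic-half zero    = 0 , refl
pronic-half (suc n) with pronic-half n
... | j , j+j≡ = j + suc n , trans (regroup j n) (trans (cong (_+ (suc n + suc n)) j+j≡) (step n))
  where
  regroup : ∀ j n → (j + suc n) + (j + suc n) ≡ (j + j) + (suc n + suc n)
  regroup = solve-∀
  step : ∀ n → n * suc n + (suc n + suc n) ≡ suc n * suc (suc n)
  step = solve-∀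

m*d≤n⇒m≤⌈n/d⌉ : ∀ m n d .{{_ : NonZero d}} → m * d ≤ n → m ≤ ⌈ n / d ⌉
m*d≤n⇒m≤⌈n/d⌉ m n d@(suc d-1) m*d≤n = begin
  m                ≡⟨ m*n/n≡m m d ⟨
  m * d / d        ≤⟨ /-monoˡ-≤ d (≤-trans m*d≤n (m≤m+n n d-1)) ⟩
  (n + d-1) / d    ≡⟨ cong (_/ d) (+-∸-assoc n (s≤s (z≤n {d-1}))) ⟨
  ⌈ n / d ⌉        ∎
  where open ≤-Reasoning

k≤C : ∀ m a .{{_ : NonZero a}} → a * a ≤ m ∸ 1 → m ∸ 1 ≤ C m a
k≤C m a a²≤k = m*d≤n⇒m≤⌈n/d⌉ k (k * ⌈ k / a ⌉) a (*-monoʳ-≤ k a≤⌈k/a⌉)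
  where
  k = m ∸ 1
  a≤⌈k/a⌉ : a ≤ ⌈ k / a ⌉
  a≤⌈k/a⌉ = m*d≤n⇒m≤⌈n/d⌉ a k a a²≤k

a²≤m-1 : ∀ a m .{{_ : NonZero a}} → 2 * (a * a) ∸ a + 2 ≤ m → a * a ≤ m ∸ 1
a²≤m-1 a m bound = begin
  a * a                       ≤⟨ m+n≤o⇒m≤o∸n (a * a) a+a²≤2a² ⟩
  2 * (a * a) ∸ a             ≤⟨ m≤m+n _ 1 ⟩
  2 * (a * a) ∸ a + 1         ≡⟨ +-∸-assoc (2 * (a * a) ∸ a) (s≤s (z≤n {1})) ⟨
  2 * (a * a) ∸ a + 2 ∸ 1     ≤⟨ ∸-monoˡ-≤ 1 bound ⟩
  m ∸ 1                       ∎
  where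
  open ≤-Reasoning
  a+a²≤2a² : a * a + a ≤ 2 * (a * a)
  a+a²≤2a² = subst (a * a + a ≤_) (cong (a * a +_) (sym (+-identityʳ (a * a))))
               (+-monoʳ-≤ (a * a) (m≤m*n a a))

m+m≤n+n⇒m≤n : ∀ m n → m + m ≤ n + n → m ≤ n
m+m≤n+n⇒m≤n m n m+m≤n+n with m ≤? n
... | yes m≤n = m≤n
... | no  m≰n = contradiction m+m≤n+n (<⇒≱ (+-mono-< (≰⇒> m≰n) (≰⇒> m≰n)))

same : (χ : Colouring) {p y : ℕ} {c : Bool} → χ p ≡ c → χ y ≡ c → χ p ≡ χ y
same χ χp χy = trans χp (sym χy)

-- The core: red a − 2 = b ≥ 1, blue a − 1 = b + 1, and a² ≤ k.  The values
-- used are v = k − 2a, Y = v + 2(a−1) = k − 2, U = v + (a−1) = k − a − 1, and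
-- j, w with 2j = a(a+1), j + w = k.

module Core (b k : ℕ) (1≤b : 1 ≤ b) (a²≤k : suc (suc b) * suc (suc b) ≤ k) where

  a v Y U : ℕ
  a = suc (suc b)
  v = k ∸ (a + a)
  Y = v + (suc b + suc b)
  U = v + suc b

  2a≤k : a + a ≤ k
  2a≤k = ≤-trans (+-monoʳ-≤ a (m≤n*m a (suc b))) a²≤k

  v+2a≡k : v + (a + a) ≡ k
  v+2a≡k = m∸n+n≡m 2a≤k

  -- Since k − 2a ≥ 0, the identity k = v + 2a turns each count into a ring identity.
  Y+2≡k : Y + 2 ≡ k
  Y+2≡k = trans (ring b v) v+2a≡k
    where
    ring : ∀ b v → v + (suc b + suc b) + 2 ≡ v + (suc (suc b) + suc (suc b))
    ring = solve-∀

  2a+v≡k : (a + a) + v ≡ k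
  2a+v≡k = trans (+-comm (a + a) v) v+2a≡k

  a+[v+a]≡k : a + (v + a) ≡ k
  a+[v+a]≡k = trans (ring b v) v+2a≡k
    where
    ring : ∀ b v → suc (suc b) + (v + suc (suc b)) ≡ v + (suc (suc b) + suc (suc b))
    ring = solve-∀

  Y+1+1≡k : suc Y + 1 ≡ k
  Y+1+1≡k = trans (sym (+-suc Y 1)) Y+2≡k

  j w : ℕ
  j = proj₁ (pronic-half a)
  w = k ∸ j

  2j≡a[a+1] : j + j ≡ a * suc a
  2j≡a[a+1] = proj₂ (pronic-half a)

  j≤k : j ≤ k
  j≤k = m+m≤n+n⇒m≤n j k (begin
    j + j          ≡⟨ 2j≡a[a+1] ⟩
    a * suc a      ≡⟨ *-suc a a ⟩
    a + a * a      ≤⟨ +-monoˡ-≤ (a * a) (m≤m*n a a) ⟩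
    a * a + a * a  ≤⟨ +-mono-≤ a²≤k a²≤k ⟩
    k + k          ∎)
    where open ≤-Reasoning

  j+w≡k : j + w ≡ k
  j+w≡k = m+[n∸m]≡n j≤k

  b≤k : b ≤ k
  b≤k = ≤-trans (n≤1+n b) (≤-trans (n≤1+n (suc b)) (≤-trans (m≤m+n a a) 2a≤k))

  b∈ : InRange k b
  b∈ = 1≤b , b≤k

  b+1∈ : InRange k (suc b)
  b+1∈ = s≤s z≤n , ≤-trans (n≤1+n (suc b)) (≤-trans (m≤m+n a a) 2a≤k)

  a∈ : InRange k a
  a∈ = s≤s z≤n , ≤-trans (m≤m+n a a) 2a≤k

  Y∈ : InRange k Y
  Y∈ = ≤-trans (s≤s z≤n) (m≤n+m (suc b + suc b) v) , subst (Y ≤_) Y+2≡k (m≤m+n Y 2)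

  U∈ : InRange k U
  U∈ = ≤-trans (s≤s z≤n) (m≤n+m (suc b) v)
     , ≤-trans (+-monoʳ-≤ v (m≤m+n (suc b) (suc b))) (proj₂ Y∈)

  sum-aBlue-YRed : Y * b + 2 * Y ≡ a * Y
  sum-aBlue-YRed = ring b Y
    where
    ring : ∀ b Y → Y * b + 2 * Y ≡ suc (suc b) * Y
    ring = solve-∀

  sum-aBlue-YBlue : (a + a) * suc b + v * a ≡ a * Y
  sum-aBlue-YBlue = ring b v
    where
    ring : ∀ b v → (suc (suc b) + suc (suc b)) * suc b + v * suc (suc b)
                     ≡ suc (suc b) * (v + (suc b + suc b))
    ring = solve-∀

  sum-aRed-YRed : a * b + (v + a) * a ≡ a * Y
  sum-aRed-YRed = ring b v
    where
    ring : ∀ b v → suc (suc b) * b + (v + suc (suc b)) * suc (suc b)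
                     ≡ suc (suc b) * (v + (suc b + suc b))
    ring = solve-∀

  sum-YBlue-UBlue : suc Y * suc b + 1 * U ≡ a * Y
  sum-YBlue-UBlue = ring b v
    where
    ring : ∀ b v → suc (v + (suc b + suc b)) * suc b + 1 * (v + suc b)
                     ≡ suc (suc b) * (v + (suc b + suc b))
    ring = solve-∀

  -- j·b + w·a = a·U: both sides plus 2j = a(a+1) equal a·k.
  sum-aRed-URed : j * b + w * a ≡ a * U
  sum-aRed-URed = +-cancelʳ-≡ (j + j) _ _ (begin
    j * b + w * a + (j + j)  ≡⟨ regroup j w b ⟩
    a * (j + w)              ≡⟨ cong (a *_) (trans j+w≡k (sym v+2a≡k)) ⟩
    a * (v + (a + a))        ≡⟨ split b v ⟩
    a * U + a * suc a        ≡⟨ cong (a * U +_) 2j≡a[a+1] ⟨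
    a * U + (j + j)          ∎)
    where
    open ≡-Reasoning
    regroup : ∀ j w b → j * b + w * suc (suc b) + (j + j) ≡ suc (suc b) * (j + w)
    regroup = solve-∀
    split : ∀ b v → suc (suc b) * (v + (suc (suc b) + suc (suc b)))
                      ≡ suc (suc b) * (v + suc b) + suc (suc b) * suc (suc (suc b))
    split = solve-∀

  monochromaticSolution : (χ : Colouring) → χ b ≡ true → χ (suc b) ≡ false → Solution k k a χ
  monochromaticSolution χ red blue with χ a in χa | χ Y in χY | χ U in χU
  ... | false | true  | _     = twoValueSolution {a = a} Y 2 b Y Y Y+2≡k sum-aBlue-YRed
                                  b∈ Y∈ Y∈ (same χ red χY) refl
  ... | false | false | _     = twoValueSolution {a = a} (a + a) v (suc b) a Y 2a+v≡k sum-aBlue-YBlue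
                                  b+1∈ a∈ Y∈ (same χ blue χY) (same χ χa χY)
  ... | true  | true  | _     = twoValueSolution {a = a} a (v + a) b a Y a+[v+a]≡k sum-aRed-YRed
                                  b∈ a∈ Y∈ (same χ red χY) (same χ χa χY)
  ... | true  | false | true  = twoValueSolution {a = a} j w b a U j+w≡k sum-aRed-URed
                                  b∈ a∈ U∈ (same χ red χU) (same χ χa χU)
  ... | true  | false | false = twoValueSolution {a = a} (suc Y) 1 (suc b) U Y Y+1+1≡k sum-YBlue-UBlue
                                  b+1∈ U∈ Y∈ (same χ blue χY) (same χ χU χY)

open Core using (monochromaticSolution)

proposition2 : (a m : ℕ) → .{{_ : NonZero a}} → 3 ≤ a → 2 * (a * a) ∸ a + 2 ≤ m →
    (χ : Colouring) → χ (a ∸ 2) ≡ true → χ (a ∸ 1) ≡ false →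
    MonoSolution (C m a) m a χ
proposition2 a@(suc (suc b)) m (s≤s (s≤s 1≤b)) bound χ red blue =
  solution-mono {a = a} (k≤C m a a²≤k) (monochromaticSolution b (m ∸ 1) 1≤b a²≤k χ red blue)
  where
  a²≤k : a * a ≤ m ∸ 1
  a²≤k = a²≤m-1 a m bound
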